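{- Let $(\mathcal{P},\mathcal{B})$ be the design defined below. The set $C_2=\{B_8^e: e\in\mathbb{Z}_{13}\}$, where $B_8=\{2_a,6_a,5_a,4_b,12_b,10_b\}$, is a non-canonical maximum clique in the block graph of $(\mathcal{P},\mathcal{B})$.
   Context: Point set: $\mathcal{P}=\mathbb{Z}_{13}\times(\{0,1,2\}\cup\{a,b\})\cup\{\infty\}$ ($66$ points); the point $(i,x)$ is written $i_x$. Basic blocks: $B_1=\{2_0,5_0,4_1,9_1,0_a,6_a\}$, $B_2=\{1_0,2_0,6_0,12_2,5_b,8_b\}$, $B_3=\{6_1,2_1,12_2,1_2,0_a,5_a\}$, $B_4=\{3_1,6_1,5_1,10_0,2_b,11_b\}$, $B_5=\{5_2,6_2,10_0,3_0,0_a,2_a\}$, $B_6=\{9_2,5_2,2_2,4_1,6_b,7_b\}$, $B_7=\{7_0,9_0,10_1,1_2,3_a,4_b\}$, $B_8=\{2_a,6_a,5_a,4_b,12_b,10_b\}$, $B_9=\{8_1,1_1,4_2,3_0,9_a,12_b\}$, $B_{10}=\{11_2,3_2,12_0,9_1,1_a,10_b\}$, $B_{11}=\{\infty,0_0,0_1,0_2,0_a,0_b\}$. For $e\in\mathbb{Z}_{13}$, $B_i^e$ is obtained from $B_i$ by replacing each point $j_x$ by $(j+e)_x$ (addition mod $13$) and fixing $\infty$. The block set is $\mathcal{B}=\{B_i^e: 1\le i\le 11,\ e\in\mathbb{Z}_{13}\}$ ($143$ blocks); $(\mathcal{P},\mathcal{B})$ is a $2$-$(66,6,1)$ design. The block graph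 has the blocks as vertices, two distinct blocks adjacent iff they intersect. A maximum clique here has size $13$; a maximum clique is canonical if it consists of all blocks containing a fixed point, and non-canonical otherwise. -}

module Defs where

open import Data.Nat using (ℕ; _+_; _≤_)
open import Data.Nat.DivMod using (_mod_)
open import Data.Fin using (Fin; toℕ; #_)
open import Data.Product using (_×_; _,_; Σ)
open import Data.Sum using (_⊎_; inj₁; inj₂)
open import Data.Unit using (⊤; tt)
open import Data.List using (List; []; _∷_; map; length; allFin)
open import Data.List.Membership.Propositional using (_∈_)
open import Data.List.Relation.Unary.Unique.Propositional using (Unique)
open import Data.Vec using (Vec; lookup) renaming (_∷_ to _∷v_; [] to []v)
open import Relation.Binary.PropositionalEquality using (_≡_; _≢_)
open import Relation.Nullary using (¬_)

-- Second coordinate of a point i_x : x ∈ {0,1,2,a,b}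
data Label : Set where
  L0 L1 L2 La Lb : Label

Z13 : Set
Z13 = Fin 13

Point : Set
Point = (Z13 × Label) ⊎ ⊤

∞ : Point
∞ = inj₂ tt

pt : ℕ → Label → Point
pt j x = inj₁ (j mod 13 , x)

-- base blocks B_1, ..., B_11 (index k : Fin 11 is B_{k+1})
baseBlocks : Vec (List Point) 11
baseBlocks =
    (pt 2 L0 ∷ pt 5 L0 ∷ pt 4 L1 ∷ pt 9 L1 ∷ pt 0 La ∷ pt 6 La ∷ [])
  ∷v (pt 1 L0 ∷ pt 2 L0 ∷ pt 6 L0 ∷ pt 12 L2 ∷ pt 5 Lb ∷ pt 8 Lb ∷ [])
  ∷v (pt 6 L1 ∷ pt 2 L1 ∷ pt 12 L2 ∷ pt 1 L2 ∷ pt 0 La ∷ pt 5 La ∷ [])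
  ∷v (pt 3 L1 ∷ pt 6 L1 ∷ pt 5 L1 ∷ pt 10 L0 ∷ pt 2 Lb ∷ pt 11 Lb ∷ [])
  ∷v (pt 5 L2 ∷ pt 6 L2 ∷ pt 10 L0 ∷ pt 3 L0 ∷ pt 0 La ∷ pt 2 La ∷ [])
  ∷v (pt 9 L2 ∷ pt 5 L2 ∷ pt 2 L2 ∷ pt 4 L1 ∷ pt 6 Lb ∷ pt 7 Lb ∷ [])
  ∷v (pt 7 L0 ∷ pt 9 L0 ∷ pt 10 L1 ∷ pt 1 L2 ∷ pt 3 La ∷ pt 4 Lb ∷ [])
  ∷v (pt 2 La ∷ pt 6 La ∷ pt 5 La ∷ pt 4 Lb ∷ pt 12 Lb ∷ pt 10 Lb ∷ [])
  ∷v (pt 8 L1 ∷ pt 1 L1 ∷ pt 4 L2 ∷ pt 3 L0 ∷ pt 9 La ∷ pt 12 Lb ∷ [])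
  ∷v (pt 11 L2 ∷ pt 3 L2 ∷ pt 12 L0 ∷ pt 9 L1 ∷ pt 1 La ∷ pt 10 Lb ∷ [])
  ∷v (∞ ∷ pt 0 L0 ∷ pt 0 L1 ∷ pt 0 L2 ∷ pt 0 La ∷ pt 0 Lb ∷ [])
  ∷v []v

shift : Z13 → Point → Point
shift e (inj₁ (j , x)) = inj₁ ((toℕ j + toℕ e) mod 13 , x)
shift e (inj₂ tt)      = inj₂ tt

-- Blocks are indexed by (i , e) : the block B_i^e
BlockIx : Set
BlockIx = Fin 11 × Z13

block : BlockIx → List Point
block (i , e) = map (shift e) (lookup baseBlocks i)

Intersect : BlockIx → BlockIx → Set
Intersect u v = Σ Point λ p → (p ∈ block u) × (p ∈ block v)

Adjacent : BlockIx → BlockIx → Set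
Adjacent u v = (u ≢ v) × Intersect u v

IsClique : List BlockIx → Set
IsClique K = Unique K × (∀ u v → u ∈ K → v ∈ K → u ≢ v → Adjacent u v)

IsMaximumClique : List BlockIx → Set
IsMaximumClique C = IsClique C × (∀ K → IsClique K → length K ≤ length C)

IsCanonical : List BlockIx → Set
IsCanonical C = Σ Point λ p → ∀ v → (v ∈ C → p ∈ block v) × (p ∈ block v → v ∈ C)

-- C_2 = { B_8^e : e ∈ Z_13 }   (B_8 has index 7 in Fin 11)
C₂ : List BlockIx
C₂ = map (λ e → (# 7 , e)) (allFin 13)

-- The translations of Z₁₃ act on the blocks and preserve intersection, so a clique can be
-- moved until its member with least base-block index i is B_i itself.
-- All other members then meet B_i and have base index at least i; an exhaustive
-- branch-and-bound search over these candidates, for each of the 11 values of i, shows that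
-- at most 12 of them are pairwise intersecting, whence every clique has at most 13 blocks.
-- The 13 translates of B₈ pairwise intersect, so C₂ is a maximum clique; it is not
-- canonical because no point lies on all of them.
module Submission where

open import Defs
open import Level using (0ℓ)
open import Function using (_∘_)
open import Function.Bundles using (Equivalence)
open import Data.Bool using (Bool; true; false; T; _∧_; _∨_)
open import Data.Bool.ListAction using (any)
open import Data.Bool.Properties using (T-∧; T-∨)
open import Data.Unit using (tt)
open import Data.Nat using (ℕ; zero; suc; _+_; _∸_; _%_; _≤_; _≤ᵇ_; _≡ᵇ_; z≤n; s≤s; NonZero)
open import Data.Nat.DivMod using (_mod_; %-distribˡ-+; m%n%n≡m%n; m<n⇒m%n≡m)
open import Data.Nat.Properties
  using (≤-trans; ≤-reflexive; ≤ᵇ⇒≤; ≡ᵇ⇒≡; ≡⇒≡ᵇ; +-assoc; +-comm; +-identityʳ; m+[n∸m]≡n; <⇒≤; module ≤-Reasoning)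
open import Data.Fin using (Fin; toℕ; #_; _≤?_) renaming (zero to 0F)
open import Data.Fin.Properties using (toℕ-injective; toℕ-fromℕ<; toℕ<n; all?; any?) renaming (_≟_ to _≟ᶠ_)
open import Data.Product using (_×_; _,_; proj₁; proj₂; ∃)
open import Data.Product.Properties using () renaming (≡-dec to ×-≡-dec)
open import Data.Sum using (inj₁; inj₂; [_,_]′)
open import Data.List using (List; []; _∷_; length; map; filter; allFin; cartesianProduct)
open import Data.List.Properties using (filter-all; length-map; map-∘; map-cong)
open import Data.List.Extrema.Nat using (argmin; argmin-sel; f[argmin]≤f[⊤]; f[argmin]≤f[xs])
open import Data.List.Relation.Unary.Any using (here; there)
open import Data.List.Relation.Unary.Any.Properties using (any⁺; any⁻)
open import Data.List.Relation.Unary.All as All using (All)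
open import Data.List.Relation.Unary.AllPairs using (_∷_)
open import Data.List.Membership.Propositional using (_∈_; _∉_; find; lose)
open import Data.List.Membership.Propositional.Properties
  using (∈-filter⁻; ∈-filter⁺; ∈-map⁺; ∈-map⁻; ∈-allFin; ∈-cartesianProduct⁺)
open import Data.List.Relation.Binary.Subset.Propositional using (_⊆_)
open import Data.List.Relation.Unary.Unique.Propositional using (Unique)
import Data.List.Relation.Unary.Unique.Propositional.Properties as Unique
open import Data.Vec using (lookup)
open import Relation.Binary using (Rel; Decidable; DecidableEquality)
open import Relation.Binary.PropositionalEquality
  using (_≡_; _≢_; refl; sym; trans; cong; cong₂; subst; module ≡-Reasoning)
open import Relation.Nullary using (¬_; Dec; yes; no; ¬?; map′; _×-dec_; contradiction)
open import Relation.Nullary.Decidable using (from-yes; T?)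

Clique : {A : Set} → Rel A 0ℓ → List A → Set
Clique R K = ∀ {u v} → u ∈ K → v ∈ K → u ≢ v → R u v

module CliqueBound {A : Set} (_≟_ : DecidableEquality A) {R : Rel A 0ℓ} (R? : Decidable R) where

  open import Data.List.Membership.DecPropositional _≟_ using (_∈?_)

  _≢?_ : (x v : A) → Dec (x ≢ v)
  x ≢? v = ¬? (x ≟ v)

  erase : A → List A → List A
  erase v = filter (_≢? v)

  ∈-erase⁻ : ∀ {v x K} → x ∈ erase v K → x ∈ K × x ≢ v
  ∈-erase⁻ {v} = ∈-filter⁻ (_≢? v)

  ∈-erase⁺ : ∀ {v x K} → x ∈ K → x ≢ v → x ∈ erase v K
  ∈-erase⁺ {v} = ∈-filter⁺ (_≢? v)

  erase-⊆ : ∀ {v K P} → K ⊆ v ∷ P → erase v K ⊆ P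
  erase-⊆ K⊆v∷P x∈ with ∈-erase⁻ x∈
  ... | x∈K , x≢v with K⊆v∷P x∈K
  ...   | here x≡v = contradiction x≡v x≢v
  ...   | there x∈P = x∈P

  Unique-erase : ∀ {v K} → Unique K → Unique (erase v K)
  Unique-erase {v} = Unique.filter⁺ (_≢? v)

  length-erase : ∀ {v K} → Unique K → length K ≤ suc (length (erase v K))
  length-erase {K = []} _ = z≤n
  length-erase {v} {x ∷ K} (x∉K ∷ uniqueK) with x ≟ v
  ... | yes refl = ≤-reflexive (cong (suc ∘ length) (sym (filter-all (_≢? v) (All.map (_∘ sym) x∉K))))
  ... | no _ = s≤s (length-erase uniqueK)

  Unique-⊆-length : ∀ {K} P → Unique K → K ⊆ P → length K ≤ length P
  Unique-⊆-length {[]} _ _ _ = z≤n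
  Unique-⊆-length {x ∷ K} [] _ K⊆[] with K⊆[] (here refl)
  ... | ()
  Unique-⊆-length (v ∷ P) uniqueK K⊆v∷P =
    ≤-trans (length-erase uniqueK) (s≤s (Unique-⊆-length P (Unique-erase uniqueK) (erase-⊆ K⊆v∷P)))

  Clique-erase : ∀ {v K} → Clique R K → Clique R (erase v K)
  Clique-erase {v} cliqueK u∈ w∈ = cliqueK (proj₁ (∈-erase⁻ {v} u∈)) (proj₁ (∈-erase⁻ {v} w∈))

  erase-⊆-neighbours : ∀ {v : A} {K P} → v ∈ K → K ⊆ v ∷ P → Clique R K → erase v K ⊆ filter (R? v) P
  erase-⊆-neighbours {v} {K} v∈K K⊆v∷P cliqueK x∈ with ∈-erase⁻ {v} {K = K} x∈
  ... | x∈K , x≢v = ∈-filter⁺ (R? v) (erase-⊆ K⊆v∷P x∈) (cliqueK v∈K x∈K (x≢v ∘ sym))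

  ∉-⊆-tail : ∀ {v : A} {K P} → v ∉ K → K ⊆ v ∷ P → K ⊆ P
  ∉-⊆-tail v∉K K⊆v∷P x∈K with K⊆v∷P x∈K
  ... | here refl = contradiction x∈K v∉K
  ... | there x∈P = x∈P

  CliquesAtMost : ℕ → List A → Set
  CliquesAtMost n P = ∀ {K} → Unique K → K ⊆ P → Clique R K → length K ≤ n

  CliquesAtMost-length : ∀ {n P} → length P ≤ n → CliquesAtMost n P
  CliquesAtMost-length {P = P} P≤n uniqueK K⊆P _ = ≤-trans (Unique-⊆-length P uniqueK K⊆P) P≤n

  -- A clique inside v ∷ P either contains v, and then its other members are neighbours of v, or lies in P.
  CliquesAtMost-∷ : ∀ {n v P} → CliquesAtMost n (filter (R? v) P) → CliquesAtMost (suc n) P →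
                    CliquesAtMost (suc n) (v ∷ P)
  CliquesAtMost-∷ {v = v} withV withoutV {K} uniqueK K⊆v∷P cliqueK with v ∈? K
  ... | yes v∈K = ≤-trans (length-erase uniqueK)
        (s≤s (withV (Unique-erase uniqueK) (erase-⊆-neighbours v∈K K⊆v∷P cliqueK) (Clique-erase {v} cliqueK)))
  ... | no v∉K = withoutV uniqueK (∉-⊆-tail v∉K K⊆v∷P) cliqueK

  boundsCliques : ℕ → List A → Bool
  boundsCliques n [] = true
  boundsCliques zero (v ∷ P) = false
  boundsCliques (suc n) (v ∷ P) =
    (length P ≤ᵇ n) ∨ (boundsCliques n (filter (R? v) P) ∧ boundsCliques (suc n) P)

  boundsCliques-sound : ∀ n P → T (boundsCliques n P) → CliquesAtMost n P
  boundsCliques-sound n [] _ = CliquesAtMost-length z≤n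
  boundsCliques-sound (suc n) (v ∷ P) bound =
    [ (λ short → CliquesAtMost-length (s≤s (≤ᵇ⇒≤ _ n short)))
    , (λ branches → CliquesAtMost-∷
         (boundsCliques-sound n (filter (R? v) P) (proj₁ (Equivalence.to T-∧ branches)))
         (boundsCliques-sound (suc n) P (proj₂ (Equivalence.to T-∧ branches)))) ]′
    (Equivalence.to T-∨ bound)

[m%d+n]%d≡[m+n]%d : ∀ m n d .{{_ : NonZero d}} → (m % d + n) % d ≡ (m + n) % d
[m%d+n]%d≡[m+n]%d m n d = begin
  (m % d + n) % d           ≡⟨ %-distribˡ-+ (m % d) n d ⟩
  (m % d % d + n % d) % d   ≡⟨ cong (λ k → (k + n % d) % d) (m%n%n≡m%n m d) ⟩
  (m % d + n % d) % d       ≡⟨ %-distribˡ-+ m n d ⟨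
  (m + n) % d               ∎
  where open ≡-Reasoning

[m+n%d]%d≡[m+n]%d : ∀ m n d .{{_ : NonZero d}} → (m + n % d) % d ≡ (m + n) % d
[m+n%d]%d≡[m+n]%d m n d = begin
  (m + n % d) % d ≡⟨ cong (_% d) (+-comm m (n % d)) ⟩
  (n % d + m) % d ≡⟨ [m%d+n]%d≡[m+n]%d n m d ⟩
  (n + m) % d     ≡⟨ cong (_% d) (+-comm n m) ⟩
  (m + n) % d     ∎
  where open ≡-Reasoning

-- Written as in shift, so that shift e (inj₁ (j , x)) is definitionally inj₁ (j ⊕ e , x).
infixl 6 _⊕_
_⊕_ : Z13 → Z13 → Z13
e ⊕ f = (toℕ e + toℕ f) mod 13

⊖_ : Z13 → Z13
⊖ e = (13 ∸ toℕ e) mod 13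

toℕ-⊕ : ∀ e f → toℕ (e ⊕ f) ≡ (toℕ e + toℕ f) % 13
toℕ-⊕ e f = toℕ-fromℕ< _

⊕-assoc : ∀ e f g → e ⊕ f ⊕ g ≡ e ⊕ (f ⊕ g)
⊕-assoc e f g = toℕ-injective (begin
  toℕ (e ⊕ f ⊕ g)                        ≡⟨ toℕ-⊕ (e ⊕ f) g ⟩
  (toℕ (e ⊕ f) + toℕ g) % 13             ≡⟨ cong (λ k → (k + toℕ g) % 13) (toℕ-⊕ e f) ⟩
  ((toℕ e + toℕ f) % 13 + toℕ g) % 13    ≡⟨ [m%d+n]%d≡[m+n]%d (toℕ e + toℕ f) (toℕ g) 13 ⟩
  (toℕ e + toℕ f + toℕ g) % 13           ≡⟨ cong (_% 13) (+-assoc (toℕ e) (toℕ f) (toℕ g)) ⟩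
  (toℕ e + (toℕ f + toℕ g)) % 13         ≡⟨ [m+n%d]%d≡[m+n]%d (toℕ e) (toℕ f + toℕ g) 13 ⟨
  (toℕ e + (toℕ f + toℕ g) % 13) % 13    ≡⟨ cong (λ k → (toℕ e + k) % 13) (toℕ-⊕ f g) ⟨
  (toℕ e + toℕ (f ⊕ g)) % 13             ≡⟨ toℕ-⊕ e (f ⊕ g) ⟨
  toℕ (e ⊕ (f ⊕ g))                      ∎)
  where open ≡-Reasoning

⊕-identityʳ : ∀ e → e ⊕ 0F ≡ e
⊕-identityʳ e = toℕ-injective (begin
  toℕ (e ⊕ 0F)        ≡⟨ toℕ-⊕ e 0F ⟩
  (toℕ e + 0) % 13    ≡⟨ cong (_% 13) (+-identityʳ (toℕ e)) ⟩
  toℕ e % 13          ≡⟨ m<n⇒m%n≡m (toℕ<n e) ⟩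
  toℕ e               ∎)
  where open ≡-Reasoning

⊕-inverseʳ : ∀ e → e ⊕ ⊖ e ≡ 0F
⊕-inverseʳ e = toℕ-injective (begin
  toℕ (e ⊕ ⊖ e)                        ≡⟨ toℕ-⊕ e (⊖ e) ⟩
  (toℕ e + toℕ (⊖ e)) % 13             ≡⟨ cong (λ k → (toℕ e + k) % 13) (toℕ-fromℕ< _) ⟩
  (toℕ e + (13 ∸ toℕ e) % 13) % 13     ≡⟨ [m+n%d]%d≡[m+n]%d (toℕ e) (13 ∸ toℕ e) 13 ⟩
  (toℕ e + (13 ∸ toℕ e)) % 13          ≡⟨ cong (_% 13) (m+[n∸m]≡n (<⇒≤ (toℕ<n e))) ⟩
  13 % 13                              ≡⟨⟩
  0                                    ∎)
  where open ≡-Reasoning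

⊕-⊖-cancelʳ : ∀ e f → e ⊕ f ⊕ ⊖ f ≡ e
⊕-⊖-cancelʳ e f = begin
  e ⊕ f ⊕ ⊖ f     ≡⟨ ⊕-assoc e f (⊖ f) ⟩
  e ⊕ (f ⊕ ⊖ f)   ≡⟨ cong (e ⊕_) (⊕-inverseʳ f) ⟩
  e ⊕ 0F          ≡⟨ ⊕-identityʳ e ⟩
  e               ∎
  where open ≡-Reasoning

⊕-cancelʳ : ∀ {e e′} f → e ⊕ f ≡ e′ ⊕ f → e ≡ e′
⊕-cancelʳ {e} {e′} f eq = begin
  e                ≡⟨ ⊕-⊖-cancelʳ e f ⟨
  e ⊕ f ⊕ ⊖ f      ≡⟨ cong (_⊕ ⊖ f) eq ⟩
  e′ ⊕ f ⊕ ⊖ f     ≡⟨ ⊕-⊖-cancelʳ e′ f ⟩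
  e′               ∎
  where open ≡-Reasoning

shift-shift : ∀ e f p → shift f (shift e p) ≡ shift (e ⊕ f) p
shift-shift e f (inj₁ (j , x)) = cong (λ k → inj₁ (k , x)) (⊕-assoc j e f)
shift-shift e f (inj₂ tt) = refl

translate : Z13 → BlockIx → BlockIx
translate f (i , e) = (i , e ⊕ f)

translate-injective : ∀ f {u v} → translate f u ≡ translate f v → u ≡ v
translate-injective f eq = cong₂ _,_ (cong proj₁ eq) (⊕-cancelʳ f (cong proj₂ eq))

block-translate : ∀ f u → block (translate f u) ≡ map (shift f) (block u)
block-translate f (i , e) = begin
  map (shift (e ⊕ f)) B            ≡⟨ map-cong (λ p → sym (shift-shift e f p)) B ⟩
  map (shift f ∘ shift e) B        ≡⟨ map-∘ B ⟩
  map (shift f) (map (shift e) B)  ∎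
  where
    open ≡-Reasoning
    B = lookup baseBlocks i

Intersect-translate : ∀ f {u v} → Intersect u v → Intersect (translate f u) (translate f v)
Intersect-translate f {u} {v} (p , p∈u , p∈v) =
  shift f p , on-translate u p∈u , on-translate v p∈v
  where
    on-translate : ∀ w → p ∈ block w → shift f p ∈ block (translate f w)
    on-translate w p∈w = subst (shift f p ∈_) (sym (block-translate f w)) (∈-map⁺ (shift f) p∈w)

Clique-translate : ∀ f {K} → Clique Intersect K → Clique Intersect (map (translate f) K)
Clique-translate f cliqueK u∈ v∈ u≢v with ∈-map⁻ (translate f) u∈ | ∈-map⁻ (translate f) v∈
... | u′ , u∈K , refl | v′ , v∈K , refl =
  Intersect-translate f {u′} {v′} (cliqueK u∈K v∈K (u≢v ∘ cong (translate f)))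

labelCode : Label → ℕ
labelCode L0 = 0
labelCode L1 = 1
labelCode L2 = 2
labelCode La = 3
labelCode Lb = 4

labelOfCode : ℕ → Label
labelOfCode 0 = L0
labelOfCode 1 = L1
labelOfCode 2 = L2
labelOfCode 3 = La
labelOfCode _ = Lb

labelOfCode-labelCode : ∀ x → labelOfCode (labelCode x) ≡ x
labelOfCode-labelCode L0 = refl
labelOfCode-labelCode L1 = refl
labelOfCode-labelCode L2 = refl
labelOfCode-labelCode La = refl
labelOfCode-labelCode Lb = refl

labelCode-injective : ∀ {x y} → labelCode x ≡ labelCode y → x ≡ y
labelCode-injective {x} {y} eq =
  trans (sym (labelOfCode-labelCode x)) (trans (cong labelOfCode eq) (labelOfCode-labelCode y))

_==ᴾ_ : Point → Point → Bool
inj₁ (i , x) ==ᴾ inj₁ (j , y) = (toℕ i ≡ᵇ toℕ j) ∧ (labelCode x ≡ᵇ labelCode y)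
inj₂ _ ==ᴾ inj₂ _ = true
inj₁ _ ==ᴾ inj₂ _ = false
inj₂ _ ==ᴾ inj₁ _ = false

==ᴾ⇒≡ : ∀ p q → T (p ==ᴾ q) → p ≡ q
==ᴾ⇒≡ (inj₁ (i , x)) (inj₁ (j , y)) p==q with Equivalence.to T-∧ p==q
... | i==j , x==y with toℕ-injective (≡ᵇ⇒≡ (toℕ i) (toℕ j) i==j)
                     | labelCode-injective (≡ᵇ⇒≡ (labelCode x) (labelCode y) x==y)
...   | refl | refl = refl
==ᴾ⇒≡ (inj₂ tt) (inj₂ tt) _ = refl

==ᴾ-refl : ∀ p → T (p ==ᴾ p)
==ᴾ-refl (inj₁ (i , x)) = Equivalence.from T-∧ (≡⇒≡ᵇ (toℕ i) (toℕ i) refl , ≡⇒≡ᵇ (labelCode x) (labelCode x) refl)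
==ᴾ-refl (inj₂ tt) = tt

_≟ᴾ_ : DecidableEquality Point
p ≟ᴾ q = map′ (==ᴾ⇒≡ p q) (λ { refl → ==ᴾ-refl p }) (T? (p ==ᴾ q))

open import Data.List.Membership.DecPropositional _≟ᴾ_ using (_∈?_)

meets : List Point → List Point → Bool
meets xs ys = any (λ p → any (p ==ᴾ_) ys) xs

-- Decided through the Boolean test meets, whose second list is evaluated once rather than once
-- per point of the first: this is what keeps the exhaustive search below fast.
intersect? : Decidable Intersect
intersect? u v = map′ sound complete (T? (meets (block u) (block v)))
  where
    sound : T (meets (block u) (block v)) → Intersect u v
    sound met with find (any⁻ _ (block u) met)
    ... | p , p∈u , p-met with find (any⁻ _ (block v) p-met)
    ...   | q , q∈v , p==q = p , p∈u , subst (_∈ block v) (sym (==ᴾ⇒≡ p q p==q)) q∈v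
    complete : Intersect u v → T (meets (block u) (block v))
    complete (p , p∈u , p∈v) = any⁺ _ (lose p∈u (any⁺ _ (lose p∈v (==ᴾ-refl p))))

_≟ᴮ_ : DecidableEquality BlockIx
_≟ᴮ_ = ×-≡-dec _≟ᶠ_ _≟ᶠ_

allBlocks : List BlockIx
allBlocks = cartesianProduct (allFin 11) (allFin 13)

∈-allBlocks : ∀ u → u ∈ allBlocks
∈-allBlocks (i , e) = ∈-cartesianProduct⁺ (∈-allFin i) (∈-allFin e)

open CliqueBound _≟ᴮ_ intersect?

candidate? : ∀ i u → Dec (toℕ i ≤ toℕ (proj₁ u) × Intersect (i , 0F) u)
candidate? i u = (i ≤? proj₁ u) ×-dec intersect? (i , 0F) u

candidates : Fin 11 → List BlockIx
candidates i = erase (i , 0F) (filter (candidate? i) allBlocks)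

candidates-cliques-≤-12 : ∀ i → T (boundsCliques 12 (candidates i))
candidates-cliques-≤-12 = from-yes (all? λ i → T? (boundsCliques 12 (candidates i)))

anchored-clique-length-≤-13 : ∀ i {K} → Unique K → Clique Intersect K → (i , 0F) ∈ K →
                              (∀ {u} → u ∈ K → toℕ i ≤ toℕ (proj₁ u)) → length K ≤ 13
anchored-clique-length-≤-13 i {K} uniqueK cliqueK anchor∈K anchor-least =
  ≤-trans (length-erase uniqueK)
          (s≤s (boundsCliques-sound 12 (candidates i) (candidates-cliques-≤-12 i)
                  (Unique-erase uniqueK) others⊆candidates (Clique-erase {i , 0F} cliqueK)))
  where
    others⊆candidates : erase (i , 0F) K ⊆ candidates i
    others⊆candidates {u} u∈ with ∈-erase⁻ {i , 0F} {K = K} u∈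
    ... | u∈K , u≢anchor = ∈-erase⁺ (∈-filter⁺ (candidate? i) (∈-allBlocks u)
                             (anchor-least u∈K , cliqueK anchor∈K u∈K (u≢anchor ∘ sym))) u≢anchor

argmin-∈ : ∀ {A : Set} (f : A → ℕ) x xs → argmin f x xs ∈ x ∷ xs
argmin-∈ f x xs = [ here , there ]′ (argmin-sel f x xs)

argmin-≤ : ∀ {A : Set} (f : A → ℕ) x xs {y} → y ∈ x ∷ xs → f (argmin f x xs) ≤ f y
argmin-≤ f x xs (here refl) = f[argmin]≤f[⊤] {f = f} x xs
argmin-≤ f x xs (there y∈xs) = All.lookup (f[argmin]≤f[xs] {f = f} x xs) y∈xs

clique-length-≤-13 : ∀ {K} → Unique K → Clique Intersect K → length K ≤ 13
clique-length-≤-13 {[]} _ _ = z≤n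
clique-length-≤-13 {K@(x ∷ xs)} uniqueK cliqueK = begin
  length K                          ≡⟨ length-map (translate (⊖ e)) K ⟨
  length (map (translate (⊖ e)) K)  ≤⟨ anchored-clique-length-≤-13 i
                                         (Unique.map⁺ (translate-injective (⊖ e)) uniqueK)
                                         (Clique-translate (⊖ e) cliqueK) anchor∈ anchor-least ⟩
  13                                ∎
  where
    open ≤-Reasoning
    index : BlockIx → ℕ
    index = toℕ ∘ proj₁
    least : BlockIx
    least = argmin index x xs
    i : Fin 11
    i = proj₁ least
    e : Z13
    e = proj₂ least
    anchor∈ : (i , 0F) ∈ map (translate (⊖ e)) K
    anchor∈ = subst (_∈ map (translate (⊖ e)) K) (cong (i ,_) (⊕-inverseʳ e))
                    (∈-map⁺ (translate (⊖ e)) (argmin-∈ index x xs))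
    anchor-least : ∀ {u} → u ∈ map (translate (⊖ e)) K → toℕ i ≤ index u
    anchor-least u∈ with ∈-map⁻ (translate (⊖ e)) u∈
    ... | _ , u∈K , refl = argmin-≤ index x xs u∈K

B₈-translate : Z13 → BlockIx
B₈-translate e = (# 7 , e)

B₈-translates-intersect : ∀ e e′ → Intersect (B₈-translate e) (B₈-translate e′)
B₈-translates-intersect = from-yes (all? λ e → all? λ e′ → intersect? (B₈-translate e) (B₈-translate e′))

B₈-points-missed : All (λ p → ∃ λ e → p ∉ block (B₈-translate e)) (block (B₈-translate 0F))
B₈-points-missed = from-yes (All.all? (λ p → any? λ e → ¬? (p ∈? block (B₈-translate e))) (block (B₈-translate 0F)))

B₈-translates-no-common-point : ∀ p → ¬ (∀ e → p ∈ block (B₈-translate e))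
B₈-translates-no-common-point p on-all with All.lookup B₈-points-missed (on-all 0F)
... | e , p∉ = p∉ (on-all e)

C₂-isClique : IsClique C₂
C₂-isClique = Unique.map⁺ {f = B₈-translate} (cong proj₂) (Unique.allFin⁺ 13) , adjacent
  where
    adjacent : ∀ u v → u ∈ C₂ → v ∈ C₂ → u ≢ v → Adjacent u v
    adjacent u v u∈ v∈ u≢v with ∈-map⁻ B₈-translate u∈ | ∈-map⁻ B₈-translate v∈
    ... | e , _ , refl | e′ , _ , refl = u≢v , B₈-translates-intersect e e′

C₂-not-canonical : ¬ IsCanonical C₂
C₂-not-canonical (p , star) =
  B₈-translates-no-common-point p (λ e → proj₁ (star (B₈-translate e)) (∈-map⁺ B₈-translate (∈-allFin e)))

proposition3p3 : IsMaximumClique C₂ × ¬ IsCanonical C₂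
proposition3p3 = (C₂-isClique , maximum) , C₂-not-canonical
  where
    maximum : ∀ K → IsClique K → length K ≤ length C₂
    maximum K (uniqueK , adjacentK) =
      clique-length-≤-13 uniqueK (λ u∈ v∈ u≢v → proj₂ (adjacentK _ _ u∈ v∈ u≢v))
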